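{- Let $t$ be an even positive integer. The set of all $t^4$ quadruples $\{(x_0,0),(x_1,1),(x_2,2),(x_3,3)\}$, $x_0,x_1,x_2,x_3\in\mathbb{Z}_t$, can be partitioned into $t^3$ parallel classes on $\mathbb{Z}_t\times\mathbb{Z}_4$, each of size $t$.
   Context: A parallel class on a set $V$ is a set of pairwise disjoint $4$-subsets of $V$ whose union is $V$. -}

module Defs where

open import Data.Nat using (ℕ; _^_)
open import Data.Fin using (Fin)
open import Data.Product using (Σ; ∃; ∃-syntax; _×_; _,_)
open import Relation.Binary.PropositionalEquality using (_≡_; _≢_)
open import Relation.Nullary using (¬_)
open import Level using (0ℓ)
open import Relation.Unary using (Pred)

Point : ℕ → Set
Point t = Fin t × Fin 4

-- A transversal quadruple {(x0,0),(x1,1),(x2,2),(x3,3)} is determined by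
-- x : Fin 4 → Fin t; as a subset of V it is the predicate below.
Quad : ℕ → Set
Quad t = Fin 4 → Fin t

quadSet : ∀ {t} → Quad t → Pred (Point t) 0ℓ
quadSet x (a , i) = x i ≡ a

IsParallelClass : ∀ {t} → (Fin t → Pred (Point t) 0ℓ) → Set
IsParallelClass {t} B =
  (∀ j k → j ≢ k → ∀ p → ¬ (B j p × B k p)) ×
  (∀ p → ∃[ j ] B j p)

_≋_ : ∀ {t} → Quad t → Quad t → Set
x ≋ y = ∀ i → x i ≡ y i

IsPartitionIntoParallelClasses : (t : ℕ) → (Fin (t ^ 3) → Fin t → Quad t) → Set
IsPartitionIntoParallelClasses t P =
  (∀ c → IsParallelClass (λ j → quadSet (P c j))) ×
  (∀ (x : Quad t) → Σ (Fin (t ^ 3) × Fin t) λ { (c , j) →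
      (P c j ≋ x) ×
      (∀ c' j' → P c' j' ≋ x → (c' ≡ c) × (j' ≡ j)) })

-- Use the cyclic group ℤ_t (indeed any loop on t points would do). A base block
-- with first coordinate the identity ε and offsets d ∈ ℤ_t³ on columns 1, 2, 3 has
-- t left translates j · (ε, d), which form a parallel class because on each column
-- right multiplication is a bijection. Conversely a quadruple x is the translate of
-- exactly one base block, by j = x₀ with offsets x₀ \\ xᵢ; so the t³ choices of d
-- index a partition of all quadruples into parallel classes.
module Submission where

open import Defs
open import Algebra.Bundles using (Group; Loop)
open import Algebra.Core using (Op₂)
open import Algebra.Structures using (IsAbelianGroup; IsLoop)
open import Algebra.Consequences.Propositional using (comm∧idˡ⇒id; comm∧invʳ⇒inv)
import Algebra.Properties.Group as GroupProperties
import Algebra.Properties.Quasigroup as QuasigroupProperties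
open import Data.Nat as ℕ using (ℕ; suc; _∸_; _<_; _^_; NonZero)
open import Data.Nat.Divisibility using (_∣_)
open import Data.Nat.DivMod using (_%_; m%n<n; %-distribˡ-+; m%n%n≡m%n; n%n≡0; m<n⇒m%n≡m)
import Data.Nat.Properties as ℕₚ
open import Data.Fin using (Fin; zero; suc; toℕ; fromℕ<; finToFun; funToFin; combine)
open import Data.Fin.Properties using (toℕ-fromℕ<; toℕ-injective; toℕ<n; toℕ≤n; finToFun-funToFin; funToFin-finToFin)
open import Data.Vec.Functional using (_∷_)
open import Data.Product using (Σ; _,_; _×_; proj₁; ∃-syntax)
open import Relation.Nullary using (¬_)
open import Function using (_∘_)
open import Level using (0ℓ)
open import Relation.Binary.PropositionalEquality

[m%n+o]%n≡[m+o]%n : ∀ m o n .{{_ : NonZero n}} → (m % n ℕ.+ o) % n ≡ (m ℕ.+ o) % n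
[m%n+o]%n≡[m+o]%n m o n = begin
  (m % n ℕ.+ o) % n           ≡⟨ %-distribˡ-+ (m % n) o n ⟩
  (m % n % n ℕ.+ o % n) % n   ≡⟨ cong (λ r → (r ℕ.+ o % n) % n) (m%n%n≡m%n m n) ⟩
  (m % n ℕ.+ o % n) % n       ≡⟨ %-distribˡ-+ m o n ⟨
  (m ℕ.+ o) % n               ∎
  where open ≡-Reasoning

[m+o%n]%n≡[m+o]%n : ∀ m o n .{{_ : NonZero n}} → (m ℕ.+ o % n) % n ≡ (m ℕ.+ o) % n
[m+o%n]%n≡[m+o]%n m o n = begin
  (m ℕ.+ o % n) % n   ≡⟨ cong (_% n) (ℕₚ.+-comm m (o % n)) ⟩
  (o % n ℕ.+ m) % n   ≡⟨ [m%n+o]%n≡[m+o]%n o m n ⟩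
  (o ℕ.+ m) % n       ≡⟨ cong (_% n) (ℕₚ.+-comm o m) ⟩
  (m ℕ.+ o) % n       ∎
  where open ≡-Reasoning

module ℤ-mod (k : ℕ) where

  private
    n : ℕ
    n = suc k

  infixl 6 _+_
  _+_ : Op₂ (Fin n)
  a + b = fromℕ< (m%n<n (toℕ a ℕ.+ toℕ b) n)

  -_ : Fin n → Fin n
  - a = fromℕ< (m%n<n (n ∸ toℕ a) n)

  toℕ-+ : ∀ a b → toℕ (a + b) ≡ (toℕ a ℕ.+ toℕ b) % n
  toℕ-+ a b = toℕ-fromℕ< (m%n<n (toℕ a ℕ.+ toℕ b) n)

  toℕ-- : ∀ a → toℕ (- a) ≡ (n ∸ toℕ a) % n
  toℕ-- a = toℕ-fromℕ< (m%n<n (n ∸ toℕ a) n)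

  +-comm : ∀ a b → a + b ≡ b + a
  +-comm a b = toℕ-injective (begin
    toℕ (a + b)              ≡⟨ toℕ-+ a b ⟩
    (toℕ a ℕ.+ toℕ b) % n    ≡⟨ cong (_% n) (ℕₚ.+-comm (toℕ a) (toℕ b)) ⟩
    (toℕ b ℕ.+ toℕ a) % n    ≡⟨ toℕ-+ b a ⟨
    toℕ (b + a)              ∎)
    where open ≡-Reasoning

  +-assoc : ∀ a b c → (a + b) + c ≡ a + (b + c)
  +-assoc a b c = toℕ-injective (begin
    toℕ ((a + b) + c)                            ≡⟨ toℕ-+ (a + b) c ⟩
    (toℕ (a + b) ℕ.+ toℕ c) % n                  ≡⟨ cong (λ r → (r ℕ.+ toℕ c) % n) (toℕ-+ a b) ⟩
    ((toℕ a ℕ.+ toℕ b) % n ℕ.+ toℕ c) % n        ≡⟨ [m%n+o]%n≡[m+o]%n (toℕ a ℕ.+ toℕ b) (toℕ c) n ⟩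
    (toℕ a ℕ.+ toℕ b ℕ.+ toℕ c) % n              ≡⟨ cong (_% n) (ℕₚ.+-assoc (toℕ a) (toℕ b) (toℕ c)) ⟩
    (toℕ a ℕ.+ (toℕ b ℕ.+ toℕ c)) % n            ≡⟨ [m+o%n]%n≡[m+o]%n (toℕ a) (toℕ b ℕ.+ toℕ c) n ⟨
    (toℕ a ℕ.+ (toℕ b ℕ.+ toℕ c) % n) % n        ≡⟨ cong (λ r → (toℕ a ℕ.+ r) % n) (toℕ-+ b c) ⟨
    (toℕ a ℕ.+ toℕ (b + c)) % n                  ≡⟨ toℕ-+ a (b + c) ⟨
    toℕ (a + (b + c))                            ∎)
    where open ≡-Reasoning

  +-identityˡ : ∀ a → zero + a ≡ a
  +-identityˡ a = toℕ-injective (trans (toℕ-+ zero a) (m<n⇒m%n≡m (toℕ<n a)))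

  +-inverseʳ : ∀ a → a + - a ≡ zero
  +-inverseʳ a = toℕ-injective (begin
    toℕ (a + - a)                          ≡⟨ toℕ-+ a (- a) ⟩
    (toℕ a ℕ.+ toℕ (- a)) % n              ≡⟨ cong (λ r → (toℕ a ℕ.+ r) % n) (toℕ-- a) ⟩
    (toℕ a ℕ.+ (n ∸ toℕ a) % n) % n        ≡⟨ [m+o%n]%n≡[m+o]%n (toℕ a) (n ∸ toℕ a) n ⟩
    (toℕ a ℕ.+ (n ∸ toℕ a)) % n            ≡⟨ cong (_% n) (ℕₚ.m+[n∸m]≡n (toℕ≤n a)) ⟩
    n % n                                  ≡⟨ n%n≡0 n ⟩
    0                                      ∎)
    where open ≡-Reasoning

  +-isAbelianGroup : IsAbelianGroup _≡_ _+_ zero -_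
  +-isAbelianGroup = record
    { isGroup = record
      { isMonoid = record
        { isSemigroup = record
          { isMagma = record { isEquivalence = isEquivalence ; ∙-cong = cong₂ _+_ }
          ; assoc = +-assoc
          }
        ; identity = comm∧idˡ⇒id +-comm +-identityˡ
        }
      ; inverse = comm∧invʳ⇒inv +-comm +-inverseʳ
      ; ⁻¹-cong = cong -_
      }
    ; comm = +-comm
    }

  +-group : Group 0ℓ 0ℓ
  +-group = record { isGroup = IsAbelianGroup.isGroup +-isAbelianGroup }

  open GroupProperties +-group public using (isLoop)

funToFin-cong : ∀ {m n} {f g : Fin m → Fin n} → (∀ i → f i ≡ g i) → funToFin f ≡ funToFin g
funToFin-cong {ℕ.zero} f≗g = refl
funToFin-cong {suc m} f≗g = cong₂ combine (f≗g zero) (funToFin-cong (f≗g ∘ suc))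

module Translates {t} {_∙_ _\\_ _//_ : Op₂ (Fin t)} {ε : Fin t}
                  (isLoop : IsLoop _≡_ _∙_ _\\_ _//_ ε) where

  open IsLoop isLoop using (identityʳ; leftDivides; rightDivides)
  private
    loop : Loop 0ℓ 0ℓ
    loop = record { isLoop = isLoop }

  open QuasigroupProperties (Loop.quasigroup loop) using (y≈x\\z; cancelʳ)

  translate : (Fin 3 → Fin t) → Fin t → Quad t
  translate d j i = j ∙ (ε ∷ d) i

  differences : Quad t → Fin 3 → Fin t
  differences x i = x zero \\ x (suc i)

  translate-isParallelClass : ∀ d → IsParallelClass (λ j → quadSet (translate d j))
  translate-isParallelClass d = disjoint , covering
    where
    disjoint : ∀ j k → j ≢ k → ∀ p → ¬ (quadSet (translate d j) p × quadSet (translate d k) p)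
    disjoint j k j≢k (a , i) (ja≡a , ka≡a) = j≢k (cancelʳ ((ε ∷ d) i) j k (trans ja≡a (sym ka≡a)))

    covering : ∀ p → ∃[ j ] quadSet (translate d j) p
    covering (a , i) = a // (ε ∷ d) i , proj₁ rightDivides ((ε ∷ d) i) a

  translate-differences : ∀ {d} x → (∀ i → d i ≡ differences x i) → translate d (x zero) ≋ x
  translate-differences x d≗ zero = identityʳ (x zero)
  translate-differences x d≗ (suc i) =
    trans (cong (x zero ∙_) (d≗ i)) (proj₁ leftDivides (x zero) (x (suc i)))

  translate-≋⇒differences : ∀ {d j x} → translate d j ≋ x → j ≡ x zero × (∀ i → d i ≡ differences x i)
  translate-≋⇒differences {d} {j} {x} tr≋x = j≡x₀ , λ i →
    trans (y≈x\\z j (d i) (x (suc i)) (tr≋x (suc i))) (cong (_\\ x (suc i)) j≡x₀)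
    where
    j≡x₀ : j ≡ x zero
    j≡x₀ = trans (sym (identityʳ j)) (tr≋x zero)

  translates : Fin (t ^ 3) → Fin t → Quad t
  translates c = translate (finToFun c)

  translates-isPartition : IsPartitionIntoParallelClasses t translates
  translates-isPartition = translate-isParallelClass ∘ finToFun , λ x →
    (funToFin (differences x) , x zero) ,
    translate-differences x (finToFun-funToFin (differences x)) ,
    λ c j tr≋x → let j≡x₀ , d≗δx = translate-≋⇒differences tr≋x in
      trans (sym (funToFin-finToFin {3} {t} c)) (funToFin-cong d≗δx) , j≡x₀

-- Translates under ℤ_t already work for every t > 0.
lemma20 : (t : ℕ) → 0 < t → 2 ∣ t →
    Σ (Fin (t ^ 3) → Fin t → Quad t) (IsPartitionIntoParallelClasses t)
lemma20 (suc k) _ _ = translates , translates-isPartition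
  where open Translates (ℤ-mod.isLoop k)
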